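{- Let $a_1,a_2,\dots$ be nonnegative integers, finitely many nonzero, with $n=\sum_i a_i\ge1$, and consider a deck with $a_i$ cards labelled $i$, arranged in a uniformly random order (uniform among all $\binom{n}{a_1,a_2,\dots}$ distinct words). Let $P_1$ be the number of cards in the first pile of patience sorting with ties allowed, and $P_1'$ the number in the first pile of patience sorting with ties forbidden. Then $$E(P_1)=\sum_{k:\,a_k>0}\frac{a_k}{a_1+\cdots+a_{k-1}+1},\qquad E(P_1')=\sum_{k:\,a_k>0}\frac{a_k}{a_1+\cdots+a_{k-1}+a_k}.$$
   Context: Patience sorting: cards are turned up one at a time and dealt into piles arranged left to right. With ties allowed, each card is placed on the leftmost pile whose top card has value greater than or equal to the card's value; with ties forbidden, on the leftmost pile whose top card has value strictly greater. If no such pile exists, the card starts a new pile to the right of the existing ones. -}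

module Defs where

open import Data.Bool using (Bool; if_then_else_)
open import Data.Nat using (ℕ; zero; suc; _+_; _≤ᵇ_; _<ᵇ_)
import Data.Nat as ℕ
open import Data.Integer using (+_)
open import Data.Rational using (ℚ; _/_; 0ℚ) renaming (_+_ to _+ℚ_)
open import Data.List using (List; []; _∷_; map; concatMap; filter; length; foldl; upTo)
open import Data.Nat.ListAction using (sum)
open import Data.List.NonEmpty using (List⁺; _∷⁺_; [_]) renaming (head to top; length to size)
open import Data.List.Properties using (≡-dec)
open import Relation.Nullary using (does)

labels : ℕ → List ℕ
labels m = map suc (upTo m)

allWords : ℕ → ℕ → List (List ℕ)
allWords m zero    = [] ∷ []
allWords m (suc n) = concatMap (λ w → map (_∷ w) (labels m)) (allWords m n)

count : ℕ → List ℕ → ℕ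
count i w = length (filter (λ x → x ℕ.≟ i) w)

counts : ℕ → List ℕ → List ℕ
counts m w = map (λ i → count i w) (labels m)

-- Multiplicities a = (a_1,...,a_m): all distinct words (each exactly once)
-- with a_i cards labelled i.
deckWords : List ℕ → List (List ℕ)
deckWords a = filter (λ w → ≡-dec ℕ._≟_ (counts (length a) w) a)
                     (allWords (length a) (sum a))

-- Patience sorting. A pile is a nonempty list whose head is its top card.
-- `fits top c` decides whether card c may be placed on a pile with top card `top`.
place : (ℕ → ℕ → Bool) → ℕ → List (List⁺ ℕ) → List (List⁺ ℕ)
place fits c []       = [ c ] ∷ []
place fits c (p ∷ ps) = if fits (top p) c then (c ∷⁺ p) ∷ ps else p ∷ place fits c ps

patience : (ℕ → ℕ → Bool) → List ℕ → List (List⁺ ℕ)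
patience fits w = foldl (λ ps c → place fits c ps) [] w

tiesAllowed : ℕ → ℕ → Bool
tiesAllowed t c = c ≤ᵇ t

tiesForbidden : ℕ → ℕ → Bool
tiesForbidden t c = c <ᵇ t

firstPileSize : List (List⁺ ℕ) → ℕ
firstPileSize []      = 0
firstPileSize (p ∷ _) = size p

P₁ : List ℕ → ℕ
P₁ w = firstPileSize (patience tiesAllowed w)

P₁' : List ℕ → ℕ
P₁' w = firstPileSize (patience tiesForbidden w)

average : List ℕ → ℚ
average []       = 0ℚ
average (x ∷ xs) = + sum (x ∷ xs) / suc (length xs)

expect : (List ℕ → ℕ) → List ℕ → ℚ
expect X a = average (map X (deckWords a))

-- p / q, with value 0 when q = 0 (only used with q > 0 below)
frac : ℕ → ℕ → ℚ
frac p zero    = 0ℚ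
frac p (suc q) = + p / suc q

-- Σ_{k : a_k > 0} a_k / (a_1+...+a_{k-1}+1); `pre` is the prefix sum
formula₁ : ℕ → List ℕ → ℚ
formula₁ pre []             = 0ℚ
formula₁ pre (zero  ∷ as)   = formula₁ pre as
formula₁ pre (suc j ∷ as)   = frac (suc j) (pre + 1) +ℚ formula₁ (pre + suc j) as

formula₂ : ℕ → List ℕ → ℚ
formula₂ pre []             = 0ℚ
formula₂ pre (zero  ∷ as)   = formula₂ pre as
formula₂ pre (suc j ∷ as)   = frac (suc j) (pre + suc j) +ℚ formula₂ (pre + suc j) as

-- A card reaches the first pile exactly when it is a left-to-right minimum of the deck order: weak
-- (no smaller card before it) with ties allowed, strict (no card at most its value before it) with ties
-- forbidden. A card labelled k is a weak minimum iff it comes first among itself and the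
-- b_k = a_1 + ⋯ + a_{k-1} smaller cards, and some card labelled k is a strict minimum iff a card labelled k
-- comes first among the b_k + a_k cards labelled at most k; summing over k gives both formulas.
--
-- For the uniform order these are proved by conditioning on the first card. With N(a) the number of deck
-- orders and e_i the i-th unit vector, the orders starting with i number N(a - e_i) = a_i N(a) / n, and
-- induction on n yields (b_k + 1) E_w = a_k N(a) for the weak count and (b_k + a_k) E_s = a_k N(a) for the
-- strict one, where E_w, E_s are the totals over all orders of the number of first-pile cards labelled k.
module Submission where

open import Defs
open import Data.Bool using (Bool; true; false; if_then_else_)
open import Data.Empty using (⊥-elim)
import Data.Integer as ℤ
import Data.Integer.Properties as ℤₚ
open import Data.Integer.Solver renaming (module +-*-Solver to ℤ-Solver)
open import Data.List using (List; []; _∷_; _++_; length; map; filter; concatMap; foldl; applyUpTo)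
open import Data.List.NonEmpty using (_∷⁺_) renaming ([_] to [_]⁺; head to top; length to size)
open import Data.List.Properties
  using (∷-injective; filter-accept; filter-reject; map-cong; map-++; map-∘; map-upTo; length-map; ≡-dec)
open import Data.List.Relation.Unary.All as All using (All; []; _∷_)
open import Data.Nat
  using (ℕ; zero; suc; pred; _≥_; _+_; _*_; _∸_; _≤_; _<_; z≤n; s≤s; z<s; _≟_; _≤?_; _<?_; >-nonZero)
open import Data.Nat.ListAction using (sum)
open import Data.Nat.ListAction.Properties using (sum-++)
open import Data.Nat.Properties
open import Algebra.Properties.CommutativeSemigroup +-commutativeSemigroup using (interchange)
open import Algebra.Properties.CommutativeSemigroup *-commutativeSemigroup
  using () renaming (x∙yz≈y∙xz to x*[y*z]≡y*[x*z])
open import Data.Product using (_×_; _,_; ∃; proj₁; proj₂)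
open import Data.Rational using (ℚ; _/_; 0ℚ; fromℚᵘ; toℚᵘ) renaming (_+_ to _+ℚ_)
import Data.Rational.Properties as ℚₚ
open import Data.Rational.Unnormalised using (mkℚᵘ; *≡*) renaming (_+_ to _+ᵘ_)
import Data.Rational.Unnormalised.Properties as ℚᵘₚ
open import Function.Bundles using (_⇔_; mk⇔)
open import Relation.Binary.PropositionalEquality
open import Relation.Nullary using (¬_; Dec; yes; no; does; contradiction)
open import Relation.Nullary.Decidable using (dec-true; dec-false; does-⇔)
open import Relation.Unary using (Decidable)

sum-map-cong : ∀ {A : Set} {f g : A → ℕ} → (∀ x → f x ≡ g x) → ∀ xs → sum (map f xs) ≡ sum (map g xs)
sum-map-cong f≗g xs = cong sum (map-cong f≗g xs)

sum-map-zero : ∀ {A : Set} {f : A → ℕ} → (∀ x → f x ≡ 0) → ∀ xs → sum (map f xs) ≡ 0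
sum-map-zero f≗0 []       = refl
sum-map-zero f≗0 (x ∷ xs) = cong₂ _+_ (f≗0 x) (sum-map-zero f≗0 xs)

sum-map-distrib-+ : ∀ {A : Set} (f g : A → ℕ) xs →
                    sum (map (λ x → f x + g x) xs) ≡ sum (map f xs) + sum (map g xs)
sum-map-distrib-+ f g []       = refl
sum-map-distrib-+ f g (x ∷ xs) =
  trans (cong (f x + g x +_) (sum-map-distrib-+ f g xs)) (interchange (f x) (g x) _ _)

*-distribˡ-sum-map : ∀ {A : Set} c (f : A → ℕ) xs → c * sum (map f xs) ≡ sum (map (λ x → c * f x) xs)
*-distribˡ-sum-map c f []       = *-zeroʳ c
*-distribˡ-sum-map c f (x ∷ xs) =
  trans (*-distribˡ-+ c (f x) _) (cong (c * f x +_) (*-distribˡ-sum-map c f xs))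

sum-map-comm : ∀ {A B : Set} (g : A → B → ℕ) xs ys →
               sum (map (λ x → sum (map (g x) ys)) xs) ≡ sum (map (λ y → sum (map (λ x → g x y) xs)) ys)
sum-map-comm g []       ys = sym (sum-map-zero (λ _ → refl) ys)
sum-map-comm g (x ∷ xs) ys =
  trans (cong (sum (map (g x) ys) +_) (sum-map-comm g xs ys)) (sym (sum-map-distrib-+ (g x) _ ys))

sum-map-concatMap : ∀ {A B : Set} (h : B → ℕ) (f : A → List B) xs →
                    sum (map h (concatMap f xs)) ≡ sum (map (λ x → sum (map h (f x))) xs)
sum-map-concatMap h f []       = refl
sum-map-concatMap h f (x ∷ xs) = begin
  sum (map h (f x ++ concatMap f xs))              ≡⟨ cong sum (map-++ h (f x) _) ⟩
  sum (map h (f x) ++ map h (concatMap f xs))      ≡⟨ sum-++ (map h (f x)) _ ⟩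
  sum (map h (f x)) + sum (map h (concatMap f xs)) ≡⟨ cong (sum (map h (f x)) +_) (sum-map-concatMap h f xs) ⟩
  sum (map h (f x)) + sum (map (λ x → sum (map h (f x))) xs) ∎
  where open ≡-Reasoning

sum-map-if : ∀ {A : Set} {P : A → Set} (P? : Decidable P) (X : A → ℕ) xs →
             sum (map X (filter P? xs)) ≡ sum (map (λ x → if does (P? x) then X x else 0) xs)
sum-map-if P? X []       = refl
sum-map-if P? X (x ∷ xs) with does (P? x)
... | true  = cong (X x +_) (sum-map-if P? X xs)
... | false = sum-map-if P? X xs

range : ℕ → ℕ → List ℕ
range lo zero    = []
range lo (suc l) = lo ∷ range (suc lo) l

labels≡range : ∀ m → labels m ≡ range 1 m
labels≡range m = trans (map-upTo suc m) (applyUpTo-range suc 1 m λ _ → refl)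
  where
  applyUpTo-range : ∀ (f : ℕ → ℕ) lo l → (∀ j → f j ≡ lo + j) → applyUpTo f l ≡ range lo l
  applyUpTo-range f lo zero    f≗ = refl
  applyUpTo-range f lo (suc l) f≗ = cong₂ _∷_ (trans (f≗ 0) (+-identityʳ lo))
    (applyUpTo-range (λ j → f (suc j)) (suc lo) l λ j → trans (f≗ (suc j)) (+-suc lo j))

∑ : ℕ → ℕ → (ℕ → ℕ) → ℕ
∑ lo l f = sum (map f (range lo l))

sum-map-labels : ∀ (g : ℕ → ℕ) m → sum (map g (labels m)) ≡ ∑ 1 m g
sum-map-labels g m = cong (λ ls → sum (map g ls)) (labels≡range m)

private
  shiftʳ : ∀ {i} lo l → i < suc lo + l → i < lo + suc l
  shiftʳ {i} lo l = subst (i <_) (sym (+-suc lo l))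

  shiftˡ : ∀ {i} lo l → i < lo + suc l → i < suc lo + l
  shiftˡ {i} lo l = subst (i <_) (+-suc lo l)

  lo<lo+suc : ∀ lo l → lo < lo + suc l
  lo<lo+suc lo l = m<m+n lo z<s

  empty-range : ∀ {lo i} → lo ≤ i → i < lo + 0 → ∀ {A : Set} → A
  empty-range {lo} {i} lo≤i i<lo+0 = ⊥-elim (<⇒≱ i<lo+0 (subst (_≤ i) (sym (+-identityʳ lo)) lo≤i))

∑-cong : ∀ lo l {f g : ℕ → ℕ} → (∀ i → lo ≤ i → i < lo + l → f i ≡ g i) → ∑ lo l f ≡ ∑ lo l g
∑-cong lo zero    eq = refl
∑-cong lo (suc l) eq = cong₂ _+_ (eq lo ≤-refl (lo<lo+suc lo l))
  (∑-cong (suc lo) l λ i lo<i i<u → eq i (<⇒≤ lo<i) (shiftʳ lo l i<u))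

∑-zero : ∀ lo l {f : ℕ → ℕ} → (∀ i → lo ≤ i → i < lo + l → f i ≡ 0) → ∑ lo l f ≡ 0
∑-zero lo l eq = trans (∑-cong lo l eq) (sum-map-zero (λ _ → refl) (range lo l))

∑-distrib-+ : ∀ lo l (f g : ℕ → ℕ) → ∑ lo l (λ i → f i + g i) ≡ ∑ lo l f + ∑ lo l g
∑-distrib-+ lo l f g = sum-map-distrib-+ f g (range lo l)

*-distribˡ-∑ : ∀ lo l c (f : ℕ → ℕ) → c * ∑ lo l f ≡ ∑ lo l (λ i → c * f i)
*-distribˡ-∑ lo l c f = *-distribˡ-sum-map c f (range lo l)

*-distribʳ-∑ : ∀ lo l c (f : ℕ → ℕ) → ∑ lo l f * c ≡ ∑ lo l (λ i → f i * c)
*-distribʳ-∑ lo l c f =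
  trans (*-comm (∑ lo l f) c) (trans (*-distribˡ-∑ lo l c f) (∑-cong lo l λ i _ _ → *-comm c (f i)))

∑-split : ∀ lo p q (f : ℕ → ℕ) → ∑ lo (p + q) f ≡ ∑ lo p f + ∑ (lo + p) q f
∑-split lo zero    q f = cong (λ lo′ → ∑ lo′ q f) (sym (+-identityʳ lo))
∑-split lo (suc p) q f = begin
  f lo + ∑ (suc lo) (p + q) f
    ≡⟨ cong (f lo +_) (∑-split (suc lo) p q f) ⟩
  f lo + (∑ (suc lo) p f + ∑ (suc lo + p) q f)
    ≡⟨ sym (+-assoc (f lo) _ _) ⟩
  f lo + ∑ (suc lo) p f + ∑ (suc lo + p) q f
    ≡⟨ cong (λ lo′ → f lo + ∑ (suc lo) p f + ∑ lo′ q f) (sym (+-suc lo p)) ⟩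
  f lo + ∑ (suc lo) p f + ∑ (lo + suc p) q f ∎
  where open ≡-Reasoning

∑-split-at : ∀ {k m} (f : ℕ → ℕ) → 1 ≤ k → k ≤ m →
             ∑ 1 m f ≡ ∑ 1 (k ∸ 1) f + (f k + ∑ (suc k) (m ∸ k) f)
∑-split-at {suc k} {m} f _ k<m = begin
  ∑ 1 m f                                 ≡⟨ cong (λ l → ∑ 1 l f) (sym m≡k+rest) ⟩
  ∑ 1 (k + suc (m ∸ suc k)) f             ≡⟨ ∑-split 1 k (suc (m ∸ suc k)) f ⟩
  ∑ 1 k f + ∑ (suc k) (suc (m ∸ suc k)) f ∎
  where
  open ≡-Reasoning
  m≡k+rest : k + suc (m ∸ suc k) ≡ m
  m≡k+rest = trans (+-suc k (m ∸ suc k)) (m+[n∸m]≡n k<m)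

δ : ℕ → ℕ → ℕ
δ i j = if does (i ≟ j) then 1 else 0

δ-same : ∀ i → δ i i ≡ 1
δ-same i = cong (if_then 1 else 0) (dec-true (i ≟ i) refl)

δ-diff : ∀ {i j} → i ≢ j → δ i j ≡ 0
δ-diff {i} {j} i≢j = cong (if_then 1 else 0) (dec-false (i ≟ j) i≢j)

∑-δ : ∀ lo l {i} → lo ≤ i → i < lo + l → ∑ lo l (δ i) ≡ 1
∑-δ lo zero        lo≤i i<lo+0 = empty-range lo≤i i<lo+0
∑-δ lo (suc l) {i} lo≤i i<u with i ≟ lo
... | yes refl = cong₂ _+_ (δ-same i) (∑-zero (suc i) l λ j i<j _ → δ-diff (<⇒≢ i<j))
... | no i≢lo  = cong₂ _+_ (δ-diff i≢lo) (∑-δ (suc lo) l (≤∧≢⇒< lo≤i (≢-sym i≢lo)) (shiftˡ lo l i<u))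

multFrom : ℕ → ℕ → List ℕ → ℕ
multFrom lo i []       = 0
multFrom lo i (x ∷ xs) = if does (i ≟ lo) then x else multFrom (suc lo) i xs

removeFrom : ℕ → ℕ → List ℕ → List ℕ
removeFrom lo i []       = []
removeFrom lo i (x ∷ xs) = if does (i ≟ lo) then pred x ∷ xs else x ∷ removeFrom (suc lo) i xs

multFrom-here : ∀ lo x xs → multFrom lo lo (x ∷ xs) ≡ x
multFrom-here lo x xs = cong (if_then x else multFrom (suc lo) lo xs) (dec-true (lo ≟ lo) refl)

multFrom-there : ∀ {lo i} x xs → i ≢ lo → multFrom lo i (x ∷ xs) ≡ multFrom (suc lo) i xs
multFrom-there {lo} {i} x xs i≢lo = cong (if_then x else multFrom (suc lo) i xs) (dec-false (i ≟ lo) i≢lo)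

removeFrom-here : ∀ lo x xs → removeFrom lo lo (x ∷ xs) ≡ pred x ∷ xs
removeFrom-here lo x xs =
  cong (if_then pred x ∷ xs else x ∷ removeFrom (suc lo) lo xs) (dec-true (lo ≟ lo) refl)

removeFrom-there : ∀ {lo i} x xs → i ≢ lo → removeFrom lo i (x ∷ xs) ≡ x ∷ removeFrom (suc lo) i xs
removeFrom-there {lo} {i} x xs i≢lo =
  cong (if_then pred x ∷ xs else x ∷ removeFrom (suc lo) i xs) (dec-false (i ≟ lo) i≢lo)

multFrom-below : ∀ lo i a → i < lo → multFrom lo i a ≡ 0
multFrom-below lo i []       i<lo = refl
multFrom-below lo i (x ∷ xs) i<lo =
  trans (multFrom-there x xs (<⇒≢ i<lo)) (multFrom-below (suc lo) i xs (m<n⇒m<1+n i<lo))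

multFrom-range : ∀ lo i a → 1 ≤ multFrom lo i a → lo ≤ i × i < lo + length a
multFrom-range lo i []       ()
multFrom-range lo i (x ∷ xs) pos with i ≟ lo
... | yes refl = ≤-refl , lo<lo+suc i (length xs)
... | no i≢lo with multFrom-range (suc lo) i xs (subst (1 ≤_) (multFrom-there x xs i≢lo) pos)
...   | lo<i , i<u = <⇒≤ lo<i , shiftʳ lo (length xs) i<u

sum≡0⇒multFrom≡0 : ∀ lo i a → sum a ≡ 0 → multFrom lo i a ≡ 0
sum≡0⇒multFrom≡0 lo i []       _     = refl
sum≡0⇒multFrom≡0 lo i (x ∷ xs) sum≡0 with i ≟ lo
... | yes refl = trans (multFrom-here i x xs) (m+n≡0⇒m≡0 x sum≡0)
... | no i≢lo  = trans (multFrom-there x xs i≢lo) (sum≡0⇒multFrom≡0 (suc lo) i xs (m+n≡0⇒n≡0 x sum≡0))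

nonzero-multFrom : ∀ lo a → 1 ≤ sum a → ∃ λ i → 1 ≤ multFrom lo i a
nonzero-multFrom lo []           ()
nonzero-multFrom lo (suc x ∷ xs) _   = lo , subst (1 ≤_) (sym (multFrom-here lo (suc x) xs)) (s≤s z≤n)
nonzero-multFrom lo (zero ∷ xs)  pos with nonzero-multFrom (suc lo) xs pos
... | i , posᵢ = i , subst (1 ≤_) (sym (skip i)) posᵢ
  where
  skip : ∀ i → multFrom lo i (zero ∷ xs) ≡ multFrom (suc lo) i xs
  skip i with i ≟ lo
  ... | yes refl = trans (multFrom-here i zero xs) (sym (multFrom-below (suc i) i xs ≤-refl))
  ... | no i≢lo  = multFrom-there zero xs i≢lo

length-removeFrom : ∀ lo i a → length (removeFrom lo i a) ≡ length a
length-removeFrom lo i []       = refl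
length-removeFrom lo i (x ∷ xs) with i ≟ lo
... | yes refl = cong length (removeFrom-here i x xs)
... | no i≢lo  =
  trans (cong length (removeFrom-there x xs i≢lo)) (cong suc (length-removeFrom (suc lo) i xs))

sum-removeFrom : ∀ lo i a → 1 ≤ multFrom lo i a → suc (sum (removeFrom lo i a)) ≡ sum a
sum-removeFrom lo i []       ()
sum-removeFrom lo i (x ∷ xs) pos with i ≟ lo
sum-removeFrom lo i (zero  ∷ xs) pos | yes refl = contradiction (subst (1 ≤_) (multFrom-here i zero xs) pos) λ ()
sum-removeFrom lo i (suc x ∷ xs) pos | yes refl = cong (λ ys → suc (sum ys)) (removeFrom-here i (suc x) xs)
... | no i≢lo = begin
  suc (sum (removeFrom lo i (x ∷ xs)))     ≡⟨ cong (λ ys → suc (sum ys)) (removeFrom-there x xs i≢lo) ⟩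
  suc (x + sum (removeFrom (suc lo) i xs)) ≡⟨ sym (+-suc x _) ⟩
  x + suc (sum (removeFrom (suc lo) i xs)) ≡⟨ cong (x +_) (sum-removeFrom (suc lo) i xs pos′) ⟩
  x + sum xs                               ∎
  where
  open ≡-Reasoning
  pos′ = subst (1 ≤_) (multFrom-there x xs i≢lo) pos

multFrom-removeFrom-same : ∀ lo i a → multFrom lo i (removeFrom lo i a) ≡ pred (multFrom lo i a)
multFrom-removeFrom-same lo i []       = refl
multFrom-removeFrom-same lo i (x ∷ xs) with i ≟ lo
... | yes refl = begin
  multFrom i i (removeFrom i i (x ∷ xs)) ≡⟨ cong (multFrom i i) (removeFrom-here i x xs) ⟩
  multFrom i i (pred x ∷ xs)             ≡⟨ multFrom-here i (pred x) xs ⟩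
  pred x                                 ≡⟨ cong pred (sym (multFrom-here i x xs)) ⟩
  pred (multFrom i i (x ∷ xs))           ∎
  where open ≡-Reasoning
... | no i≢lo = begin
  multFrom lo i (removeFrom lo i (x ∷ xs))       ≡⟨ cong (multFrom lo i) (removeFrom-there x xs i≢lo) ⟩
  multFrom lo i (x ∷ removeFrom (suc lo) i xs)   ≡⟨ multFrom-there x (removeFrom (suc lo) i xs) i≢lo ⟩
  multFrom (suc lo) i (removeFrom (suc lo) i xs) ≡⟨ multFrom-removeFrom-same (suc lo) i xs ⟩
  pred (multFrom (suc lo) i xs)                  ≡⟨ cong pred (sym (multFrom-there x xs i≢lo)) ⟩
  pred (multFrom lo i (x ∷ xs))                  ∎
  where open ≡-Reasoning

multFrom-removeFrom-other : ∀ lo {i j} a → j ≢ i → multFrom lo j (removeFrom lo i a) ≡ multFrom lo j a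
multFrom-removeFrom-other lo           []       j≢i = refl
multFrom-removeFrom-other lo {i} {j} (x ∷ xs) j≢i with i ≟ lo | j ≟ lo
... | yes refl | _        = begin
  multFrom i j (removeFrom i i (x ∷ xs)) ≡⟨ cong (multFrom i j) (removeFrom-here i x xs) ⟩
  multFrom i j (pred x ∷ xs)             ≡⟨ multFrom-there (pred x) xs j≢i ⟩
  multFrom (suc i) j xs                  ≡⟨ sym (multFrom-there x xs j≢i) ⟩
  multFrom i j (x ∷ xs)                  ∎
  where open ≡-Reasoning
... | no i≢lo  | yes refl = begin
  multFrom j j (removeFrom j i (x ∷ xs))     ≡⟨ cong (multFrom j j) (removeFrom-there x xs i≢lo) ⟩
  multFrom j j (x ∷ removeFrom (suc j) i xs) ≡⟨ multFrom-here j x (removeFrom (suc j) i xs) ⟩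
  x                                          ≡⟨ sym (multFrom-here j x xs) ⟩
  multFrom j j (x ∷ xs)                      ∎
  where open ≡-Reasoning
... | no i≢lo  | no j≢lo  = begin
  multFrom lo j (removeFrom lo i (x ∷ xs))       ≡⟨ cong (multFrom lo j) (removeFrom-there x xs i≢lo) ⟩
  multFrom lo j (x ∷ removeFrom (suc lo) i xs)   ≡⟨ multFrom-there x (removeFrom (suc lo) i xs) j≢lo ⟩
  multFrom (suc lo) j (removeFrom (suc lo) i xs) ≡⟨ multFrom-removeFrom-other (suc lo) xs j≢i ⟩
  multFrom (suc lo) j xs                         ≡⟨ sym (multFrom-there x xs j≢lo) ⟩
  multFrom lo j (x ∷ xs)                         ∎
  where open ≡-Reasoning

removeFrom-comm : ∀ lo i j a → removeFrom lo i (removeFrom lo j a) ≡ removeFrom lo j (removeFrom lo i a)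
removeFrom-comm lo i j []       = refl
removeFrom-comm lo i j (x ∷ xs) with i ≟ lo | j ≟ lo
... | yes refl | yes refl = refl
... | yes refl | no j≢lo  = begin
  removeFrom i i (removeFrom i j (x ∷ xs))     ≡⟨ cong (removeFrom i i) (removeFrom-there x xs j≢lo) ⟩
  removeFrom i i (x ∷ removeFrom (suc i) j xs) ≡⟨ removeFrom-here i x _ ⟩
  pred x ∷ removeFrom (suc i) j xs             ≡⟨ sym (removeFrom-there (pred x) xs j≢lo) ⟩
  removeFrom i j (pred x ∷ xs)                 ≡⟨ cong (removeFrom i j) (sym (removeFrom-here i x xs)) ⟩
  removeFrom i j (removeFrom i i (x ∷ xs))     ∎
  where open ≡-Reasoning
... | no i≢lo  | yes refl = begin
  removeFrom j i (removeFrom j j (x ∷ xs))     ≡⟨ cong (removeFrom j i) (removeFrom-here j x xs) ⟩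
  removeFrom j i (pred x ∷ xs)                 ≡⟨ removeFrom-there (pred x) xs i≢lo ⟩
  pred x ∷ removeFrom (suc j) i xs             ≡⟨ sym (removeFrom-here j x _) ⟩
  removeFrom j j (x ∷ removeFrom (suc j) i xs) ≡⟨ cong (removeFrom j j) (sym (removeFrom-there x xs i≢lo)) ⟩
  removeFrom j j (removeFrom j i (x ∷ xs))     ∎
  where open ≡-Reasoning
... | no i≢lo  | no j≢lo  = begin
  removeFrom lo i (removeFrom lo j (x ∷ xs))           ≡⟨ cong (removeFrom lo i) (removeFrom-there x xs j≢lo) ⟩
  removeFrom lo i (x ∷ removeFrom (suc lo) j xs)       ≡⟨ removeFrom-there x _ i≢lo ⟩
  x ∷ removeFrom (suc lo) i (removeFrom (suc lo) j xs) ≡⟨ cong (x ∷_) (removeFrom-comm (suc lo) i j xs) ⟩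
  x ∷ removeFrom (suc lo) j (removeFrom (suc lo) i xs) ≡⟨ sym (removeFrom-there x _ j≢lo) ⟩
  removeFrom lo j (x ∷ removeFrom (suc lo) i xs)       ≡⟨ cong (removeFrom lo j) (sym (removeFrom-there x xs i≢lo)) ⟩
  removeFrom lo j (removeFrom lo i (x ∷ xs))           ∎
  where open ≡-Reasoning

count-here : ∀ i w → count i (i ∷ w) ≡ suc (count i w)
count-here i w = cong length (filter-accept (_≟ i) refl)

count-there : ∀ {c i} w → c ≢ i → count i (c ∷ w) ≡ count i w
count-there {c} {i} w c≢i = cong length (filter-reject (_≟ i) c≢i)

countsFrom : ℕ → ℕ → List ℕ → List ℕ
countsFrom lo m w = map (λ i → count i w) (range lo m)

counts≡countsFrom : ∀ m w → counts m w ≡ countsFrom 1 m w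
counts≡countsFrom m w = cong (map (λ i → count i w)) (labels≡range m)

countsFrom-[] : ∀ lo a → sum a ≡ 0 → countsFrom lo (length a) [] ≡ a
countsFrom-[] lo []       _     = refl
countsFrom-[] lo (x ∷ xs) sum≡0 =
  cong₂ _∷_ (sym (m+n≡0⇒m≡0 x sum≡0)) (countsFrom-[] (suc lo) xs (m+n≡0⇒n≡0 x sum≡0))

countsFrom-∷-below : ∀ lo l {c} w → c < lo → countsFrom lo l (c ∷ w) ≡ countsFrom lo l w
countsFrom-∷-below lo zero    w c<lo = refl
countsFrom-∷-below lo (suc l) w c<lo =
  cong₂ _∷_ (count-there w (<⇒≢ c<lo)) (countsFrom-∷-below (suc lo) l w (m<n⇒m<1+n c<lo))

countsFrom-∷⁻ : ∀ lo {i} a w → lo ≤ i → i < lo + length a → countsFrom lo (length a) (i ∷ w) ≡ a →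
                1 ≤ multFrom lo i a × countsFrom lo (length a) w ≡ removeFrom lo i a
countsFrom-∷⁻ lo []       w lo≤i i<lo+0 _ = empty-range lo≤i i<lo+0
countsFrom-∷⁻ lo {i} (x ∷ xs) w lo≤i i<u eq with i ≟ lo | ∷-injective eq
... | yes refl | countᵢ≡x , rest≡xs = pos , (begin
  countsFrom i (suc (length xs)) w ≡⟨ cong₂ _∷_ (cong pred (trans (sym (count-here i w)) countᵢ≡x))
                                                (trans (sym (countsFrom-∷-below (suc i) _ w ≤-refl)) rest≡xs) ⟩
  pred x ∷ xs                      ≡⟨ sym (removeFrom-here i x xs) ⟩
  removeFrom i i (x ∷ xs)          ∎)
  where
  open ≡-Reasoning
  pos = subst (1 ≤_) (trans (trans (sym (count-here i w)) countᵢ≡x) (sym (multFrom-here i x xs))) (s≤s z≤n)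
... | no i≢lo  | countₗₒ≡x , rest≡xs
  with countsFrom-∷⁻ (suc lo) xs w (≤∧≢⇒< lo≤i (≢-sym i≢lo)) (shiftˡ lo (length xs) i<u) rest≡xs
...  | pos , rest≡ =
  subst (1 ≤_) (sym (multFrom-there x xs i≢lo)) pos ,
  trans (cong₂ _∷_ (trans (sym (count-there w i≢lo)) countₗₒ≡x) rest≡) (sym (removeFrom-there x xs i≢lo))

countsFrom-∷⁺ : ∀ lo {i} a w → 1 ≤ multFrom lo i a → countsFrom lo (length a) w ≡ removeFrom lo i a →
                countsFrom lo (length a) (i ∷ w) ≡ a
countsFrom-∷⁺ lo {i} [] w () _
countsFrom-∷⁺ lo {i} (x ∷ xs) w pos eq with i ≟ lo
... | yes refl with x | ∷-injective (trans eq (removeFrom-here i x xs))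
...   | zero  | _ = contradiction (subst (1 ≤_) (multFrom-here i zero xs) pos) λ ()
...   | suc y | countᵢ≡y , rest≡xs = cong₂ _∷_ (trans (count-here i w) (cong suc countᵢ≡y))
  (trans (countsFrom-∷-below (suc i) (length xs) w ≤-refl) rest≡xs)
countsFrom-∷⁺ lo {i} (x ∷ xs) w pos eq | no i≢lo with ∷-injective (trans eq (removeFrom-there x xs i≢lo))
... | countₗₒ≡x , rest≡ = cong₂ _∷_ (trans (count-there w i≢lo) countₗₒ≡x)
  (countsFrom-∷⁺ (suc lo) xs w (subst (1 ≤_) (multFrom-there x xs i≢lo) pos) rest≡)

mult : ℕ → List ℕ → ℕ
mult = multFrom 1

remove : ℕ → List ℕ → List ℕ
remove = removeFrom 1

sum-remove : ∀ {n} a i → 1 ≤ mult i a → sum a ≡ suc n → sum (remove i a) ≡ n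
sum-remove a i pos sum≡ = suc-injective (trans (sum-removeFrom 1 i a pos) sum≡)

mult-remove-≤ : ∀ a i c → mult c (remove i a) ≤ mult c a
mult-remove-≤ a i c with c ≟ i
... | yes refl = ≤-trans (≤-reflexive (multFrom-removeFrom-same 1 c a)) pred[n]≤n
... | no c≢i   = ≤-reflexive (multFrom-removeFrom-other 1 a c≢i)

suc-mult-remove : ∀ a k → 1 ≤ mult k a → suc (mult k (remove k a)) ≡ mult k a
suc-mult-remove a k pos =
  trans (cong suc (multFrom-removeFrom-same 1 k a)) (suc-pred (mult k a) {{>-nonZero pos}})

k≤length-remove : ∀ {k} a i → k ≤ length a → k ≤ length (remove i a)
k≤length-remove a i = subst (_ ≤_) (sym (length-removeFrom 1 i a))

counts-∷⁻ : ∀ a {i} w → 1 ≤ i → i ≤ length a → counts (length a) (i ∷ w) ≡ a →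
            1 ≤ mult i a × counts (length a) w ≡ remove i a
counts-∷⁻ a {i} w 1≤i i≤m eq
  with countsFrom-∷⁻ 1 a w 1≤i (s≤s i≤m) (trans (sym (counts≡countsFrom (length a) (i ∷ w))) eq)
... | pos , eq′ = pos , trans (counts≡countsFrom _ w) eq′

counts-∷⁺ : ∀ a {i} w → 1 ≤ mult i a → counts (length a) w ≡ remove i a → counts (length a) (i ∷ w) ≡ a
counts-∷⁺ a {i} w pos eq = trans (counts≡countsFrom (length a) (i ∷ w))
  (countsFrom-∷⁺ 1 a w pos (trans (sym (counts≡countsFrom (length a) w)) eq))

deckSum : (List ℕ → ℕ) → List ℕ → ℕ
deckSum X a = sum (map X (deckWords a))

deckSize : List ℕ → ℕ
deckSize = deckSum (λ _ → 1)

ifNonZero : ℕ → ℕ → ℕ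
ifNonZero zero    _ = 0
ifNonZero (suc _) y = y

ifNonZero-cong : ∀ x {y z} → (1 ≤ x → y ≡ z) → ifNonZero x y ≡ ifNonZero x z
ifNonZero-cong zero    _   = refl
ifNonZero-cong (suc _) y≡z = y≡z (s≤s z≤n)

ifNonZero-pos : ∀ {x} y → 1 ≤ x → ifNonZero x y ≡ y
ifNonZero-pos {suc _} y _ = refl

ifNonZero-0 : ∀ x → ifNonZero x 0 ≡ 0
ifNonZero-0 zero    = refl
ifNonZero-0 (suc _) = refl

*-ifNonZero : ∀ c x y → c * ifNonZero x y ≡ ifNonZero x (c * y)
*-ifNonZero c zero    y = *-zeroʳ c
*-ifNonZero c (suc _) y = refl

inDeck? : ∀ m b w → Dec (counts m w ≡ b)
inDeck? m b w = ≡-dec _≟_ (counts m w) b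

wordsOf : ℕ → ℕ → List ℕ → List (List ℕ)
wordsOf m n b = filter (inDeck? m b) (allWords m n)

deckSum-[] : ∀ X a → sum a ≡ 0 → deckSum X a ≡ X []
deckSum-[] X a sum≡0 = begin
  deckSum X a                 ≡⟨ cong (λ n → sum (map X (wordsOf m n a))) sum≡0 ⟩
  sum (map X (wordsOf m 0 a)) ≡⟨ cong (λ ws → sum (map X ws)) (filter-accept (inDeck? m a) counts≡a) ⟩
  X [] + 0                    ≡⟨ +-identityʳ (X []) ⟩
  X []                        ∎
  where
  open ≡-Reasoning
  m = length a
  counts≡a : counts m [] ≡ a
  counts≡a = trans (counts≡countsFrom m []) (countsFrom-[] 1 a sum≡0)

sum-inDeck-∷ : ∀ (X : List ℕ → ℕ) a {n} i → sum a ≡ suc n → 1 ≤ i → i ≤ length a →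
  sum (map (λ w → if does (inDeck? (length a) a (i ∷ w)) then X (i ∷ w) else 0) (allWords (length a) n)) ≡
  ifNonZero (mult i a) (deckSum (λ w → X (i ∷ w)) (remove i a))
sum-inDeck-∷ X a {n} i sum≡ 1≤i i≤m with mult i a in multᵢ
... | zero  = sum-map-zero (λ w → cong (if_then X (i ∷ w) else 0) (dec-false (inDeck? m a (i ∷ w)) (absent w))) ws
  where
  m  = length a
  ws = allWords m n
  absent : ∀ w → ¬ counts m (i ∷ w) ≡ a
  absent w eq = contradiction (subst (1 ≤_) multᵢ (proj₁ (counts-∷⁻ a w 1≤i i≤m eq))) λ ()
... | suc _ = begin
  sum (map (λ w → if does (inDeck? m a (i ∷ w)) then X (i ∷ w) else 0) ws)
    ≡⟨ sum-map-cong (λ w → cong (if_then X (i ∷ w) else 0)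
                                (does-⇔ (iff w) (inDeck? m a (i ∷ w)) (inDeck? m a′ w))) ws ⟩
  sum (map (λ w → if does (inDeck? m a′ w) then X (i ∷ w) else 0) ws)
    ≡⟨ sym (sum-map-if (inDeck? m a′) (λ w → X (i ∷ w)) ws) ⟩
  sum (map (λ w → X (i ∷ w)) (wordsOf m n a′))
    ≡⟨ cong₂ (λ m′ n′ → sum (map (λ w → X (i ∷ w)) (wordsOf m′ n′ a′)))
             (sym (length-removeFrom 1 i a)) (sym (sum-remove a i pos sum≡)) ⟩
  deckSum (λ w → X (i ∷ w)) a′ ∎
  where
  open ≡-Reasoning
  m  = length a
  ws = allWords m n
  a′ = remove i a
  pos : 1 ≤ mult i a
  pos = subst (1 ≤_) (sym multᵢ) (s≤s z≤n)
  iff : ∀ w → counts m (i ∷ w) ≡ a ⇔ counts m w ≡ a′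
  iff w = mk⇔ (λ eq → proj₂ (counts-∷⁻ a w 1≤i i≤m eq)) (counts-∷⁺ a w pos)

deckSum-∷ : ∀ X a {n} → sum a ≡ suc n →
            deckSum X a ≡ ∑ 1 (length a) (λ i → ifNonZero (mult i a) (deckSum (λ w → X (i ∷ w)) (remove i a)))
deckSum-∷ X a {n} sum≡ = begin
  deckSum X a
    ≡⟨ cong (λ n → sum (map X (wordsOf m n a))) sum≡ ⟩
  sum (map X (filter (inDeck? m a) (concatMap (λ w → map (_∷ w) (labels m)) ws)))
    ≡⟨ sum-map-if (inDeck? m a) X (concatMap (λ w → map (_∷ w) (labels m)) ws) ⟩
  sum (map X? (concatMap (λ w → map (_∷ w) (labels m)) ws))
    ≡⟨ sum-map-concatMap X? _ ws ⟩
  sum (map (λ w → sum (map X? (map (_∷ w) (labels m)))) ws)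
    ≡⟨ sum-map-cong (λ w → cong sum (sym (map-∘ (labels m)))) ws ⟩
  sum (map (λ w → sum (map (λ i → X? (i ∷ w)) (labels m))) ws)
    ≡⟨ sum-map-comm (λ w i → X? (i ∷ w)) ws (labels m) ⟩
  sum (map (λ i → sum (map (λ w → X? (i ∷ w)) ws)) (labels m))
    ≡⟨ sum-map-labels _ m ⟩
  ∑ 1 m (λ i → sum (map (λ w → X? (i ∷ w)) ws))
    ≡⟨ ∑-cong 1 m (λ i 1≤i i<1+m → sum-inDeck-∷ X a i sum≡ 1≤i (≤-pred i<1+m)) ⟩
  ∑ 1 m (λ i → ifNonZero (mult i a) (deckSum (λ w → X (i ∷ w)) (remove i a))) ∎
  where
  open ≡-Reasoning
  m  = length a
  ws = allWords m n
  X? : List ℕ → ℕ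
  X? w = if does (inDeck? m a w) then X w else 0

deckSum-cong : ∀ a {X Y : List ℕ → ℕ} → (∀ w → All (λ c → 1 ≤ mult c a) w → X w ≡ Y w) →
               deckSum X a ≡ deckSum Y a
deckSum-cong a = go (sum a) a refl
  where
  go : ∀ n a {X Y : List ℕ → ℕ} → sum a ≡ n →
       (∀ w → All (λ c → 1 ≤ mult c a) w → X w ≡ Y w) → deckSum X a ≡ deckSum Y a
  go zero    a {X} {Y} sum≡ X≗Y = trans (deckSum-[] X a sum≡) (trans (X≗Y [] []) (sym (deckSum-[] Y a sum≡)))
  go (suc n) a {X} {Y} sum≡ X≗Y = begin
    deckSum X a
      ≡⟨ deckSum-∷ X a sum≡ ⟩
    ∑ 1 (length a) (λ i → ifNonZero (mult i a) (deckSum (λ w → X (i ∷ w)) (remove i a)))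
      ≡⟨ ∑-cong 1 (length a) (λ i _ _ → ifNonZero-cong (mult i a) (tail i)) ⟩
    ∑ 1 (length a) (λ i → ifNonZero (mult i a) (deckSum (λ w → Y (i ∷ w)) (remove i a)))
      ≡⟨ sym (deckSum-∷ Y a sum≡) ⟩
    deckSum Y a ∎
    where
    open ≡-Reasoning
    tail : ∀ i → 1 ≤ mult i a →
           deckSum (λ w → X (i ∷ w)) (remove i a) ≡ deckSum (λ w → Y (i ∷ w)) (remove i a)
    tail i pos = go n (remove i a) (sum-remove a i pos sum≡) λ w occurs →
      X≗Y (i ∷ w) (pos ∷ All.map (λ {c} 1≤multᶜ → ≤-trans 1≤multᶜ (mult-remove-≤ a i c)) occurs)

deckSum-≗ : ∀ a {X Y : List ℕ → ℕ} → (∀ w → X w ≡ Y w) → deckSum X a ≡ deckSum Y a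
deckSum-≗ a X≗Y = sum-map-cong X≗Y (deckWords a)

deckSum-suc : ∀ X a → deckSum (λ w → suc (X w)) a ≡ deckSize a + deckSum X a
deckSum-suc X a = sum-map-distrib-+ (λ _ → 1) X (deckWords a)

deckSum-zero : ∀ {X} a → (∀ w → X w ≡ 0) → deckSum X a ≡ 0
deckSum-zero a X≗0 = sum-map-zero X≗0 (deckWords a)

deckSum-∑ : ∀ lo l (X : ℕ → List ℕ → ℕ) a →
            deckSum (λ w → ∑ lo l (λ k → X k w)) a ≡ ∑ lo l (λ k → deckSum (X k) a)
deckSum-∑ lo l X a = sum-map-comm (λ w k → X k w) (deckWords a) (range lo l)

startingWith : ℕ → List ℕ → ℕ
startingWith i a = ifNonZero (mult i a) (deckSize (remove i a))

deckSize-∷ : ∀ a {n} → sum a ≡ suc n → deckSize a ≡ ∑ 1 (length a) (λ i → startingWith i a)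
deckSize-∷ a = deckSum-∷ (λ _ → 1) a

*-deckSize-∷ : ∀ n a → sum a ≡ n → n * deckSize a ≡ n * ∑ 1 (length a) (λ j → startingWith j a)
*-deckSize-∷ zero    a _    = refl
*-deckSize-∷ (suc n) a sum≡ = cong (suc n *_) (deckSize-∷ a sum≡)

-- The inductive step of mult-*-deckSize below, taking that identity for decks of n cards as hypothesis.
*-startingWith-step : ∀ {n c} a i j → sum a ≡ suc n → mult i a ≡ suc c →
  (∀ b k → sum b ≡ n → mult k b * deckSize b ≡ n * startingWith k b) →
  suc c * startingWith j a ≡ deckSize (remove i a) * δ i j + n * startingWith j (remove i a)
*-startingWith-step {n} {c} a i j sum≡ multᵢ hyp with j ≟ i
... | yes refl = begin
  suc c * startingWith i a           ≡⟨ cong (suc c *_) (ifNonZero-pos N′ pos) ⟩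
  N′ + c * N′                        ≡⟨ cong (λ x → N′ + x * N′) (sym mult-a′) ⟩
  N′ + mult i a′ * N′                ≡⟨ cong₂ _+_ (sym (*-identityʳ N′)) (hyp a′ i sum-a′) ⟩
  N′ * 1 + n * startingWith i a′     ≡⟨ cong (λ x → N′ * x + n * startingWith i a′) (sym (δ-same i)) ⟩
  N′ * δ i i + n * startingWith i a′ ∎
  where
  open ≡-Reasoning
  a′ = remove i a
  N′ = deckSize a′
  pos : 1 ≤ mult i a
  pos = subst (1 ≤_) (sym multᵢ) (s≤s z≤n)
  sum-a′ : sum a′ ≡ n
  sum-a′ = sum-remove a i pos sum≡
  mult-a′ : mult i a′ ≡ c
  mult-a′ = trans (multFrom-removeFrom-same 1 i a) (cong pred multᵢ)
... | no j≢i = begin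
  suc c * startingWith j a                             ≡⟨ *-ifNonZero (suc c) (mult j a) _ ⟩
  ifNonZero (mult j a) (suc c * deckSize (remove j a)) ≡⟨ ifNonZero-cong (mult j a) first-j ⟩
  ifNonZero (mult j a) (n * deckSize (remove j a′))    ≡⟨ cong (λ x → ifNonZero x (n * deckSize (remove j a′)))
                                                               (sym (multFrom-removeFrom-other 1 a j≢i)) ⟩
  ifNonZero (mult j a′) (n * deckSize (remove j a′))   ≡⟨ sym (*-ifNonZero n (mult j a′) _) ⟩
  n * startingWith j a′                                ≡⟨ cong (_+ n * startingWith j a′) (sym N′*δ≡0) ⟩
  N′ * δ i j + n * startingWith j a′                   ∎
  where
  open ≡-Reasoning
  a′ = remove i a
  N′ = deckSize a′
  N′*δ≡0 : N′ * δ i j ≡ 0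
  N′*δ≡0 = trans (cong (N′ *_) (δ-diff (≢-sym j≢i))) (*-zeroʳ N′)
  multᵢ-unchanged : suc c ≡ mult i (remove j a)
  multᵢ-unchanged = sym (trans (multFrom-removeFrom-other 1 a (≢-sym j≢i)) multᵢ)
  posᵢ : 1 ≤ mult i (remove j a)
  posᵢ = subst (1 ≤_) multᵢ-unchanged (s≤s z≤n)
  first-j : 1 ≤ mult j a → suc c * deckSize (remove j a) ≡ n * deckSize (remove j a′)
  first-j posⱼ = begin
    suc c * deckSize (remove j a)               ≡⟨ cong (_* deckSize (remove j a)) multᵢ-unchanged ⟩
    mult i (remove j a) * deckSize (remove j a) ≡⟨ hyp (remove j a) i (sum-remove a j posⱼ sum≡) ⟩
    n * startingWith i (remove j a)             ≡⟨ cong (n *_) (ifNonZero-pos _ posᵢ) ⟩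
    n * deckSize (remove i (remove j a))        ≡⟨ cong (λ b → n * deckSize b) (removeFrom-comm 1 i j a) ⟩
    n * deckSize (remove j a′)                  ∎

mult-*-deckSize : ∀ n a i → sum a ≡ n → mult i a * deckSize a ≡ n * startingWith i a
mult-*-deckSize zero    a i sum≡0 = cong (_* deckSize a) (sum≡0⇒multFrom≡0 1 i a sum≡0)
mult-*-deckSize (suc n) a i sum≡ with mult i a in multᵢ
... | zero  = sym (*-zeroʳ (suc n))
... | suc c = begin
  suc c * deckSize a
    ≡⟨ cong (suc c *_) (deckSize-∷ a sum≡) ⟩
  suc c * ∑ 1 m (λ j → startingWith j a)
    ≡⟨ *-distribˡ-∑ 1 m (suc c) _ ⟩
  ∑ 1 m (λ j → suc c * startingWith j a)
    ≡⟨ ∑-cong 1 m (λ j _ _ → *-startingWith-step a i j sum≡ multᵢ (mult-*-deckSize n)) ⟩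
  ∑ 1 m (λ j → N′ * δ i j + n * startingWith j a′)
    ≡⟨ ∑-distrib-+ 1 m _ _ ⟩
  ∑ 1 m (λ j → N′ * δ i j) + ∑ 1 m (λ j → n * startingWith j a′)
    ≡⟨ cong₂ _+_ (sym (*-distribˡ-∑ 1 m N′ (δ i))) (sym (*-distribˡ-∑ 1 m n _)) ⟩
  N′ * ∑ 1 m (δ i) + n * ∑ 1 m (λ j → startingWith j a′)
    ≡⟨ cong₂ _+_ (trans (cong (N′ *_) (∑-δ 1 m 1≤i i<1+m)) (*-identityʳ N′)) rest ⟩
  N′ + n * N′ ∎
  where
  open ≡-Reasoning
  m  = length a
  a′ = remove i a
  N′ = deckSize a′
  pos : 1 ≤ mult i a
  pos = subst (1 ≤_) (sym multᵢ) (s≤s z≤n)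
  1≤i : 1 ≤ i
  1≤i = proj₁ (multFrom-range 1 i a pos)
  i<1+m : i < 1 + m
  i<1+m = proj₂ (multFrom-range 1 i a pos)
  rest : n * ∑ 1 m (λ j → startingWith j a′) ≡ n * N′
  rest = trans (cong (λ l → n * ∑ 1 l (λ j → startingWith j a′)) (sym (length-removeFrom 1 i a)))
               (sym (*-deckSize-∷ n a′ (sum-remove a i pos sum≡)))

deckSize-pos : ∀ a → 1 ≤ deckSize a
deckSize-pos a = go (sum a) a refl
  where
  go : ∀ n a → sum a ≡ n → 1 ≤ deckSize a
  go zero    a sum≡0 = ≤-reflexive (sym (deckSum-[] (λ _ → 1) a sum≡0))
  go (suc n) a sum≡ with nonzero-multFrom 1 a (subst (1 ≤_) (sym sum≡) (s≤s z≤n))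
  ... | i , pos = n≢0⇒n>0 λ N≡0 → contradiction (begin
      1                             ≤⟨ *-mono-≤ (s≤s (z≤n {n})) (go n (remove i a) (sum-remove a i pos sum≡)) ⟩
      suc n * deckSize (remove i a) ≡⟨ cong (suc n *_) (sym (ifNonZero-pos _ pos)) ⟩
      suc n * startingWith i a      ≡⟨ sym (mult-*-deckSize (suc n) a i sum≡) ⟩
      mult i a * deckSize a         ≡⟨ cong (mult i a *_) N≡0 ⟩
      mult i a * 0                  ≡⟨ *-zeroʳ (mult i a) ⟩
      0                             ∎) λ ()
    where open ≤-Reasoning

below : ℕ → List ℕ → ℕ
below k a = ∑ 1 (k ∸ 1) (λ i → mult i a)

below-remove : ∀ k {i} a → k ≤ i → below k (remove i a) ≡ below k a
below-remove zero    a _   = refl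
below-remove (suc k) a k<i =
  ∑-cong 1 k λ j _ j<1+k → multFrom-removeFrom-other 1 a (<⇒≢ (<-≤-trans j<1+k k<i))

below-*-startingWith : ∀ {n} a k → sum a ≡ suc n →
                       below k a * startingWith k a ≡ mult k a * ∑ 1 (k ∸ 1) (λ i → startingWith i a)
below-*-startingWith {n} a k sum≡ = *-cancelˡ-≡ _ _ (suc n) (begin
  suc n * (B * startingWith k a)
    ≡⟨ x*[y*z]≡y*[x*z] (suc n) B _ ⟩
  B * (suc n * startingWith k a)
    ≡⟨ cong (B *_) (sym (mult-*-deckSize (suc n) a k sum≡)) ⟩
  B * (mult k a * deckSize a)
    ≡⟨ x*[y*z]≡y*[x*z] B (mult k a) _ ⟩
  mult k a * (B * deckSize a)
    ≡⟨ cong (mult k a *_) (*-distribʳ-∑ 1 (k ∸ 1) (deckSize a) (λ i → mult i a)) ⟩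
  mult k a * ∑ 1 (k ∸ 1) (λ i → mult i a * deckSize a)
    ≡⟨ cong (mult k a *_) (∑-cong 1 (k ∸ 1) λ i _ _ → mult-*-deckSize (suc n) a i sum≡) ⟩
  mult k a * ∑ 1 (k ∸ 1) (λ i → suc n * startingWith i a)
    ≡⟨ cong (mult k a *_) (sym (*-distribˡ-∑ 1 (k ∸ 1) (suc n) _)) ⟩
  mult k a * (suc n * ∑ 1 (k ∸ 1) (λ i → startingWith i a))
    ≡⟨ x*[y*z]≡y*[x*z] (mult k a) (suc n) _ ⟩
  suc n * (mult k a * ∑ 1 (k ∸ 1) (λ i → startingWith i a)) ∎)
  where
  open ≡-Reasoning
  B = below k a

mult-*-deckSize-split : ∀ {n} a k → sum a ≡ suc n → 1 ≤ k → k ≤ length a →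
  mult k a * deckSize a ≡
  (below k a + mult k a) * startingWith k a + mult k a * ∑ (suc k) (length a ∸ k) (λ i → startingWith i a)
mult-*-deckSize-split a k sum≡ 1≤k k≤m = begin
  aₖ * deckSize a
    ≡⟨ cong (aₖ *_) (trans (deckSize-∷ a sum≡) (∑-split-at (λ i → startingWith i a) 1≤k k≤m)) ⟩
  aₖ * (Tₗ + (Tₖ + Tᵣ))
    ≡⟨ *-distribˡ-+ aₖ Tₗ _ ⟩
  aₖ * Tₗ + aₖ * (Tₖ + Tᵣ)
    ≡⟨ cong₂ _+_ (sym (below-*-startingWith a k sum≡)) (*-distribˡ-+ aₖ Tₖ Tᵣ) ⟩
  below k a * Tₖ + (aₖ * Tₖ + aₖ * Tᵣ)
    ≡⟨ sym (+-assoc (below k a * Tₖ) _ _) ⟩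
  below k a * Tₖ + aₖ * Tₖ + aₖ * Tᵣ
    ≡⟨ cong (_+ aₖ * Tᵣ) (sym (*-distribʳ-+ Tₖ (below k a) aₖ)) ⟩
  (below k a + aₖ) * Tₖ + aₖ * Tᵣ ∎
  where
  open ≡-Reasoning
  aₖ = mult k a
  Tₗ = ∑ 1 (k ∸ 1) (λ i → startingWith i a)
  Tₖ = startingWith k a
  Tᵣ = ∑ (suc k) (length a ∸ k) (λ i → startingWith i a)

-- Conditioning on the first card (below, equal to or above k): the inductive step shared by
-- deckSum-firstPileCount-weak and deckSum-firstPileCount-strict.
deckSum-weighted : ∀ {n} a k (X : List ℕ → ℕ) q → sum a ≡ suc n → 1 ≤ k → k ≤ length a →
  (∀ i → i < k → 1 ≤ mult i a → deckSum (λ w → X (i ∷ w)) (remove i a) ≡ 0) →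
  (1 ≤ mult k a →
     q * deckSum (λ w → X (k ∷ w)) (remove k a) ≡ (below k a + mult k a) * deckSize (remove k a)) →
  (∀ i → k < i → 1 ≤ mult i a →
     q * deckSum (λ w → X (i ∷ w)) (remove i a) ≡ mult k a * deckSize (remove i a)) →
  q * deckSum X a ≡ mult k a * deckSize a
deckSum-weighted a k X q sum≡ 1≤k k≤m first-below first-at first-above = begin
  q * deckSum X a
    ≡⟨ cong (q *_) (trans (deckSum-∷ X a sum≡) (∑-split-at term 1≤k k≤m)) ⟩
  q * (∑ 1 (k ∸ 1) term + (term k + Rest))
    ≡⟨ cong (λ x → q * (x + (term k + Rest))) (∑-zero 1 (k ∸ 1) λ i _ i<u → term-below i (below-k i<u)) ⟩
  q * (term k + Rest)
    ≡⟨ *-distribˡ-+ q (term k) Rest ⟩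
  q * term k + q * Rest
    ≡⟨ cong₂ _+_ (q*term k (below k a + mult k a) first-at) term-above ⟩
  (below k a + mult k a) * startingWith k a + mult k a * ∑ (suc k) (m ∸ k) (λ i → startingWith i a)
    ≡⟨ sym (mult-*-deckSize-split a k sum≡ 1≤k k≤m) ⟩
  mult k a * deckSize a ∎
  where
  open ≡-Reasoning
  m = length a
  term : ℕ → ℕ
  term i = ifNonZero (mult i a) (deckSum (λ w → X (i ∷ w)) (remove i a))
  Rest = ∑ (suc k) (m ∸ k) term
  below-k : ∀ {i} → i < 1 + (k ∸ 1) → i < k
  below-k i<u = <-≤-trans i<u (≤-reflexive (m+[n∸m]≡n 1≤k))
  q*term : ∀ i c → (1 ≤ mult i a → q * deckSum (λ w → X (i ∷ w)) (remove i a) ≡ c * deckSize (remove i a)) →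
           q * term i ≡ c * startingWith i a
  q*term i c eq = begin
    q * term i                                                        ≡⟨ *-ifNonZero q (mult i a) _ ⟩
    ifNonZero (mult i a) (q * deckSum (λ w → X (i ∷ w)) (remove i a)) ≡⟨ ifNonZero-cong (mult i a) eq ⟩
    ifNonZero (mult i a) (c * deckSize (remove i a))                  ≡⟨ sym (*-ifNonZero c (mult i a) _) ⟩
    c * startingWith i a                                              ∎
  term-below : ∀ i → i < k → term i ≡ 0
  term-below i i<k = trans (ifNonZero-cong (mult i a) (first-below i i<k)) (ifNonZero-0 (mult i a))
  term-above : q * Rest ≡ mult k a * ∑ (suc k) (m ∸ k) (λ i → startingWith i a)
  term-above = begin
    q * Rest                                              ≡⟨ *-distribˡ-∑ (suc k) (m ∸ k) q term ⟩
    ∑ (suc k) (m ∸ k) (λ i → q * term i)                  ≡⟨ ∑-cong (suc k) (m ∸ k) (λ i k<i _ →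
                                                               q*term i (mult k a) (first-above i k<i)) ⟩
    ∑ (suc k) (m ∸ k) (λ i → mult k a * startingWith i a) ≡⟨ sym (*-distribˡ-∑ (suc k) (m ∸ k) (mult k a) _) ⟩
    mult k a * ∑ (suc k) (m ∸ k) (λ i → startingWith i a) ∎

deckSum-weighted-[] : ∀ {X} a q k → sum a ≡ 0 → X [] ≡ 0 → q * deckSum X a ≡ mult k a * deckSize a
deckSum-weighted-[] {X} a q k sum≡0 X[]≡0 = begin
  q * deckSum X a       ≡⟨ cong (q *_) (trans (deckSum-[] X a sum≡0) X[]≡0) ⟩
  q * 0                 ≡⟨ *-zeroʳ q ⟩
  0                     ≡⟨ cong (_* deckSize a) (sym (sum≡0⇒multFrom≡0 1 k a sum≡0)) ⟩
  mult k a * deckSize a ∎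
  where open ≡-Reasoning

firstPileFrom : (ℕ → ℕ → Bool) → ℕ → List ℕ → ℕ
firstPileFrom fits t []      = 0
firstPileFrom fits t (c ∷ w) = if fits t c then suc (firstPileFrom fits c w) else firstPileFrom fits t w

firstPileCount : (ℕ → ℕ → Bool) → ℕ → ℕ → List ℕ → ℕ
firstPileCount fits k t []      = 0
firstPileCount fits k t (c ∷ w) =
  if fits t c then δ c k + firstPileCount fits k c w else firstPileCount fits k t w

firstPileSize-patience : ∀ fits {t} w → All (λ c → fits t c ≡ true) w →
                         firstPileSize (patience fits w) ≡ firstPileFrom fits t w
firstPileSize-patience fits []      _ = refl
firstPileSize-patience fits {t} (c ∷ w) (fitsᶜ ∷ _) = begin
  firstPileSize (patience fits (c ∷ w)) ≡⟨ firstPile-foldl [ c ]⁺ [] w ⟩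
  suc (firstPileFrom fits c w)          ≡⟨ cong (if_then suc (firstPileFrom fits c w) else firstPileFrom fits t w)
                                                (sym fitsᶜ) ⟩
  firstPileFrom fits t (c ∷ w)          ∎
  where
  open ≡-Reasoning
  firstPile-foldl : ∀ p ps w →
    firstPileSize (foldl (λ ps c → place fits c ps) (p ∷ ps) w) ≡ size p + firstPileFrom fits (top p) w
  firstPile-foldl p ps []      = sym (+-identityʳ (size p))
  firstPile-foldl p ps (c ∷ w) with fits (top p) c
  ... | true  = trans (firstPile-foldl (c ∷⁺ p) ps w) (sym (+-suc (size p) _))
  ... | false = firstPile-foldl p (place fits c ps) w

firstPileFrom≡∑ : ∀ fits m t w → All (λ c → 1 ≤ c × c < 1 + m) w →
                  firstPileFrom fits t w ≡ ∑ 1 m (λ k → firstPileCount fits k t w)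
firstPileFrom≡∑ fits m t []      _ = sym (∑-zero 1 m λ _ _ _ → refl)
firstPileFrom≡∑ fits m t (c ∷ w) ((1≤c , c<1+m) ∷ inRange) with fits t c
... | true  = begin
  suc (firstPileFrom fits c w)
    ≡⟨ cong₂ _+_ (sym (∑-δ 1 m 1≤c c<1+m)) (firstPileFrom≡∑ fits m c w inRange) ⟩
  ∑ 1 m (δ c) + ∑ 1 m (λ k → firstPileCount fits k c w)
    ≡⟨ sym (∑-distrib-+ 1 m (δ c) _) ⟩
  ∑ 1 m (λ k → δ c k + firstPileCount fits k c w) ∎
  where open ≡-Reasoning
... | false = firstPileFrom≡∑ fits m t w inRange

newTop : (ℕ → ℕ → Bool) → ℕ → ℕ → ℕ
newTop fits t c = if fits t c then c else t

newTop-preserves : ∀ fits (P : ℕ → Set) {t c} → P t → P c → P (newTop fits t c)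
newTop-preserves fits P {t} {c} Pt Pc with fits t c
... | true  = Pc
... | false = Pt

module _ (fits : ℕ → ℕ → Bool) {k t : ℕ} (c : ℕ) (w : List ℕ) where

  firstPileCount-∷-fit : fits t c ≡ true → firstPileCount fits k t (c ∷ w) ≡ δ c k + firstPileCount fits k c w
  firstPileCount-∷-fit =
    cong (if_then δ c k + firstPileCount fits k c w else firstPileCount fits k t w)

  firstPileCount-∷-unfit : fits t c ≡ false → firstPileCount fits k t (c ∷ w) ≡ firstPileCount fits k t w
  firstPileCount-∷-unfit =
    cong (if_then δ c k + firstPileCount fits k c w else firstPileCount fits k t w)

  firstPileCount-∷-≢ : c ≢ k → firstPileCount fits k t (c ∷ w) ≡ firstPileCount fits k (newTop fits t c) w
  firstPileCount-∷-≢ c≢k with fits t c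
  ... | true  = cong (_+ firstPileCount fits k c w) (δ-diff c≢k)
  ... | false = refl

firstPileCount-absent : ∀ fits k t w → All (_≢ k) w → firstPileCount fits k t w ≡ 0
firstPileCount-absent fits k t []      _            = refl
firstPileCount-absent fits k t (c ∷ w) (c≢k ∷ rest) =
  trans (firstPileCount-∷-≢ fits c w c≢k) (firstPileCount-absent fits k (newTop fits t c) w rest)

fits-weak : ∀ {t c} → c ≤ t → tiesAllowed t c ≡ true
fits-weak {t} {c} = dec-true (c ≤? t)

unfits-weak : ∀ {t c} → ¬ c ≤ t → tiesAllowed t c ≡ false
unfits-weak {t} {c} = dec-false (c ≤? t)

fits-strict : ∀ {t c} → c < t → tiesForbidden t c ≡ true
fits-strict {t} {c} = dec-true (c <? t)

unfits-strict : ∀ {t c} → ¬ c < t → tiesForbidden t c ≡ false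
unfits-strict {t} {c} = dec-false (c <? t)

firstPileCount-weak-below : ∀ k t w → t < k → firstPileCount tiesAllowed k t w ≡ 0
firstPileCount-weak-below k t []      _   = refl
firstPileCount-weak-below k t (c ∷ w) t<k with c ≤? t
... | yes c≤t = trans (firstPileCount-∷-fit tiesAllowed c w (fits-weak c≤t))
                      (cong₂ _+_ (δ-diff (<⇒≢ c<k)) (firstPileCount-weak-below k c w c<k))
  where c<k = ≤-<-trans c≤t t<k
... | no c≰t  = trans (firstPileCount-∷-unfit tiesAllowed c w (unfits-weak c≰t))
                      (firstPileCount-weak-below k t w t<k)

firstPileCount-strict-below : ∀ k t w → t ≤ k → firstPileCount tiesForbidden k t w ≡ 0
firstPileCount-strict-below k t []      _   = refl
firstPileCount-strict-below k t (c ∷ w) t≤k with c <? t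
... | yes c<t = trans (firstPileCount-∷-fit tiesForbidden c w (fits-strict c<t))
                      (cong₂ _+_ (δ-diff (<⇒≢ c<k)) (firstPileCount-strict-below k c w (<⇒≤ c<k)))
  where c<k = <-≤-trans c<t t≤k
... | no c≮t  = trans (firstPileCount-∷-unfit tiesForbidden c w (unfits-strict c≮t))
                      (firstPileCount-strict-below k t w t≤k)

deckSum-firstPileCount-weak : ∀ n a k t → sum a ≡ n → 1 ≤ k → k ≤ length a → k ≤ t →
               (below k a + 1) * deckSum (firstPileCount tiesAllowed k t) a ≡ mult k a * deckSize a
deckSum-firstPileCount-weak zero    a k t sum≡0 _   _   _   = deckSum-weighted-[] a (below k a + 1) k sum≡0 refl
deckSum-firstPileCount-weak (suc n) a k t sum≡  1≤k k≤m k≤t =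
  deckSum-weighted a k (X t) (B + 1) sum≡ 1≤k k≤m first-below first-here first-above
  where
  X : ℕ → List ℕ → ℕ
  X = firstPileCount tiesAllowed k
  B = below k a
  first-below : ∀ i → i < k → 1 ≤ mult i a → deckSum (λ w → X t (i ∷ w)) (remove i a) ≡ 0
  first-below i i<k _ = deckSum-zero (remove i a) λ w →
    trans (firstPileCount-∷-fit tiesAllowed i w (fits-weak (≤-trans (<⇒≤ i<k) k≤t)))
          (cong₂ _+_ (δ-diff (<⇒≢ i<k)) (firstPileCount-weak-below k i w i<k))
  first-here : 1 ≤ mult k a →
               (B + 1) * deckSum (λ w → X t (k ∷ w)) (remove k a) ≡ (B + mult k a) * deckSize (remove k a)
  first-here pos = begin
    (B + 1) * deckSum (λ w → X t (k ∷ w)) a′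
      ≡⟨ cong ((B + 1) *_) (trans (deckSum-≗ a′ here) (deckSum-suc (X k) a′)) ⟩
    (B + 1) * (N′ + deckSum (X k) a′)
      ≡⟨ *-distribˡ-+ (B + 1) N′ _ ⟩
    (B + 1) * N′ + (B + 1) * deckSum (X k) a′
      ≡⟨ cong (λ x → (B + 1) * N′ + (x + 1) * deckSum (X k) a′) (sym (below-remove k a ≤-refl)) ⟩
    (B + 1) * N′ + (below k a′ + 1) * deckSum (X k) a′
      ≡⟨ cong ((B + 1) * N′ +_) (deckSum-firstPileCount-weak n a′ k k sum-a′ 1≤k k≤m′ ≤-refl) ⟩
    (B + 1) * N′ + mult k a′ * N′
      ≡⟨ sym (*-distribʳ-+ N′ (B + 1) (mult k a′)) ⟩
    (B + 1 + mult k a′) * N′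
      ≡⟨ cong (_* N′) (trans (+-assoc B 1 _) (cong (B +_) (suc-mult-remove a k pos))) ⟩
    (B + mult k a) * N′ ∎
    where
    open ≡-Reasoning
    a′ = remove k a
    N′ = deckSize a′
    sum-a′ : sum a′ ≡ n
    sum-a′ = sum-remove a k pos sum≡
    k≤m′ = k≤length-remove a k k≤m
    here : ∀ w → X t (k ∷ w) ≡ suc (X k w)
    here w = trans (firstPileCount-∷-fit tiesAllowed k w (fits-weak k≤t)) (cong (_+ X k w) (δ-same k))
  first-above : ∀ i → k < i → 1 ≤ mult i a →
                (B + 1) * deckSum (λ w → X t (i ∷ w)) (remove i a) ≡ mult k a * deckSize (remove i a)
  first-above i k<i pos = begin
    (B + 1) * deckSum (λ w → X t (i ∷ w)) a′
      ≡⟨ cong ((B + 1) *_) (deckSum-≗ a′ λ w → firstPileCount-∷-≢ tiesAllowed i w (≢-sym (<⇒≢ k<i))) ⟩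
    (B + 1) * deckSum (X t′) a′
      ≡⟨ cong (λ x → (x + 1) * deckSum (X t′) a′) (sym (below-remove k a (<⇒≤ k<i))) ⟩
    (below k a′ + 1) * deckSum (X t′) a′
      ≡⟨ deckSum-firstPileCount-weak n a′ k t′ (sum-remove a i pos sum≡) 1≤k k≤m′ k≤t′ ⟩
    mult k a′ * deckSize a′
      ≡⟨ cong (_* deckSize a′) (multFrom-removeFrom-other 1 a (<⇒≢ k<i)) ⟩
    mult k a * deckSize a′ ∎
    where
    open ≡-Reasoning
    a′ = remove i a
    t′ = newTop tiesAllowed t i
    k≤m′ = k≤length-remove a i k≤m
    k≤t′ : k ≤ t′
    k≤t′ = newTop-preserves tiesAllowed (k ≤_) k≤t (<⇒≤ k<i)

deckSum-firstPileCount-strict : ∀ n a k t → sum a ≡ n → 1 ≤ k → k ≤ length a → k < t →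
                 (below k a + mult k a) * deckSum (firstPileCount tiesForbidden k t) a ≡ mult k a * deckSize a
deckSum-firstPileCount-strict zero    a k t sum≡0 _   _   _   = deckSum-weighted-[] a (below k a + mult k a) k sum≡0 refl
deckSum-firstPileCount-strict (suc n) a k t sum≡  1≤k k≤m k<t =
  deckSum-weighted a k (X t) q sum≡ 1≤k k≤m first-below first-here first-above
  where
  X : ℕ → List ℕ → ℕ
  X = firstPileCount tiesForbidden k
  q = below k a + mult k a
  first-below : ∀ i → i < k → 1 ≤ mult i a → deckSum (λ w → X t (i ∷ w)) (remove i a) ≡ 0
  first-below i i<k _ = deckSum-zero (remove i a) λ w →
    trans (firstPileCount-∷-fit tiesForbidden i w (fits-strict (<-trans i<k k<t)))
          (cong₂ _+_ (δ-diff (<⇒≢ i<k)) (firstPileCount-strict-below k i w (<⇒≤ i<k)))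
  first-here : 1 ≤ mult k a → q * deckSum (λ w → X t (k ∷ w)) (remove k a) ≡ q * deckSize (remove k a)
  first-here _ = cong (q *_) (deckSum-≗ (remove k a) λ w →
    trans (firstPileCount-∷-fit tiesForbidden k w (fits-strict k<t))
          (cong₂ _+_ (δ-same k) (firstPileCount-strict-below k k w ≤-refl)))
  first-above : ∀ i → k < i → 1 ≤ mult i a →
                q * deckSum (λ w → X t (i ∷ w)) (remove i a) ≡ mult k a * deckSize (remove i a)
  first-above i k<i pos = begin
    q * deckSum (λ w → X t (i ∷ w)) a′
      ≡⟨ cong (q *_) (deckSum-≗ a′ λ w → firstPileCount-∷-≢ tiesForbidden i w (≢-sym (<⇒≢ k<i))) ⟩
    q * deckSum (X t′) a′
      ≡⟨ cong₂ (λ x y → (x + y) * deckSum (X t′) a′) (below-remove k a (<⇒≤ k<i)) multₖ-unchanged ⟨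
    (below k a′ + mult k a′) * deckSum (X t′) a′
      ≡⟨ deckSum-firstPileCount-strict n a′ k t′ (sum-remove a i pos sum≡) 1≤k k≤m′ k<t′ ⟩
    mult k a′ * deckSize a′
      ≡⟨ cong (_* deckSize a′) multₖ-unchanged ⟩
    mult k a * deckSize a′ ∎
    where
    open ≡-Reasoning
    a′ = remove i a
    t′ = newTop tiesForbidden t i
    k≤m′ = k≤length-remove a i k≤m
    k<t′ : k < t′
    k<t′ = newTop-preserves tiesForbidden (k <_) k<t k<i
    multₖ-unchanged : mult k a′ ≡ mult k a
    multₖ-unchanged = multFrom-removeFrom-other 1 a (<⇒≢ k<i)

deckSum-firstPileCount-absent : ∀ fits a k t → mult k a ≡ 0 → deckSum (firstPileCount fits k t) a ≡ 0
deckSum-firstPileCount-absent fits a k t multₖ≡0 = trans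
  (deckSum-cong a λ w occurs → firstPileCount-absent fits k t w (All.map ≢k occurs))
  (deckSum-zero a λ _ → refl)
  where
  ≢k : ∀ {c} → 1 ≤ mult c a → c ≢ k
  ≢k pos refl = contradiction (subst (1 ≤_) multₖ≡0 pos) λ ()

deckSum-firstPileSize : ∀ fits T a → (∀ c → c < 1 + length a → fits T c ≡ true) →
  deckSum (λ w → firstPileSize (patience fits w)) a ≡ ∑ 1 (length a) (λ k → deckSum (firstPileCount fits k T) a)
deckSum-firstPileSize fits T a fitsᵀ = begin
  deckSum (λ w → firstPileSize (patience fits w)) a         ≡⟨ deckSum-cong a pointwise ⟩
  deckSum (λ w → ∑ 1 m (λ k → firstPileCount fits k T w)) a ≡⟨ deckSum-∑ 1 m _ a ⟩
  ∑ 1 m (λ k → deckSum (firstPileCount fits k T) a)         ∎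
  where
  open ≡-Reasoning
  m = length a
  inRange : ∀ {c} → 1 ≤ mult c a → 1 ≤ c × c < 1 + m
  inRange {c} = multFrom-range 1 c a
  pointwise : ∀ w → All (λ c → 1 ≤ mult c a) w →
              firstPileSize (patience fits w) ≡ ∑ 1 m (λ k → firstPileCount fits k T w)
  pointwise w occurs = trans
    (firstPileSize-patience fits w (All.map (λ {c} pos → fitsᵀ c (proj₂ (inRange pos))) occurs))
    (firstPileFrom≡∑ fits m T w (All.map inRange occurs))

fromℚᵘ-+ : ∀ x y → fromℚᵘ (x +ᵘ y) ≡ fromℚᵘ x +ℚ fromℚᵘ y
fromℚᵘ-+ x y = ℚₚ.toℚᵘ-injective (begin
  toℚᵘ (fromℚᵘ (x +ᵘ y))             ≈⟨ ℚₚ.toℚᵘ-fromℚᵘ (x +ᵘ y) ⟩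
  x +ᵘ y                             ≈⟨ ℚᵘₚ.+-cong (ℚₚ.toℚᵘ-fromℚᵘ x) (ℚₚ.toℚᵘ-fromℚᵘ y) ⟨
  toℚᵘ (fromℚᵘ x) +ᵘ toℚᵘ (fromℚᵘ y) ≈⟨ ℚₚ.toℚᵘ-homo-+ (fromℚᵘ x) (fromℚᵘ y) ⟨
  toℚᵘ (fromℚᵘ x +ℚ fromℚᵘ y)        ∎)
  where open ℚᵘₚ.≃-Reasoning

/-distrib-+ : ∀ p q d → ℤ.+ (p + q) / suc d ≡ ℤ.+ p / suc d +ℚ ℤ.+ q / suc d
/-distrib-+ p q d = trans
  (ℚₚ.fromℚᵘ-cong {mkℚᵘ (ℤ.+ (p + q)) d} {mkℚᵘ (ℤ.+ p) d +ᵘ mkℚᵘ (ℤ.+ q) d} (*≡* same-numerators))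
  (fromℚᵘ-+ (mkℚᵘ (ℤ.+ p) d) (mkℚᵘ (ℤ.+ q) d))
  where
  open ℤ-Solver
  D = ℤ.+ suc d
  same-numerators : ℤ.+ (p + q) ℤ.* (D ℤ.* D) ≡ (ℤ.+ p ℤ.* D ℤ.+ ℤ.+ q ℤ.* D) ℤ.* D
  same-numerators = solve 3 (λ p q D → (p :+ q) :* (D :* D) := (p :* D :+ q :* D) :* D) refl (ℤ.+ p) (ℤ.+ q) D

/-cross : ∀ a b c d → a * suc d ≡ c * suc b → ℤ.+ a / suc b ≡ ℤ.+ c / suc d
/-cross a b c d eq = ℚₚ.fromℚᵘ-cong {mkℚᵘ (ℤ.+ a) b} {mkℚᵘ (ℤ.+ c) d}
  (*≡* (trans (sym (ℤₚ.pos-* a (suc d))) (trans (cong ℤ.+_ eq) (ℤₚ.pos-* c (suc b)))))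

/-≡-frac : ∀ f x q d → 1 ≤ x → q * f ≡ x * suc d → ℤ.+ f / suc d ≡ frac x q
/-≡-frac f (suc x) zero    d _ eq = contradiction eq λ ()
/-≡-frac f x       (suc q) d _ eq = /-cross f d x q (trans (*-comm f (suc q)) eq)

frac-sum : (ℕ → ℕ → ℕ) → ℕ → List ℕ → ℚ
frac-sum den pre []           = 0ℚ
frac-sum den pre (zero  ∷ as) = frac-sum den pre as
frac-sum den pre (suc j ∷ as) = frac (suc j) (den pre (suc j)) +ℚ frac-sum den (pre + suc j) as

formula₁≡frac-sum : ∀ pre a → formula₁ pre a ≡ frac-sum (λ p _ → p + 1) pre a
formula₁≡frac-sum pre []           = refl
formula₁≡frac-sum pre (zero  ∷ as) = formula₁≡frac-sum pre as
formula₁≡frac-sum pre (suc j ∷ as) =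
  cong (frac (suc j) (pre + 1) +ℚ_) (formula₁≡frac-sum (pre + suc j) as)

formula₂≡frac-sum : ∀ pre a → formula₂ pre a ≡ frac-sum _+_ pre a
formula₂≡frac-sum pre []           = refl
formula₂≡frac-sum pre (zero  ∷ as) = formula₂≡frac-sum pre as
formula₂≡frac-sum pre (suc j ∷ as) =
  cong (frac (suc j) (pre + suc j) +ℚ_) (formula₂≡frac-sum (pre + suc j) as)

∑-multFrom-∷ : ∀ {lo k} x xs → lo < k →
  ∑ lo (k ∸ lo) (λ i → multFrom lo i (x ∷ xs)) ≡ x + ∑ (suc lo) (k ∸ suc lo) (λ i → multFrom (suc lo) i xs)
∑-multFrom-∷ {lo} {suc k} x xs (s≤s lo≤k) = begin
  ∑ lo (suc k ∸ lo) (λ i → multFrom lo i (x ∷ xs))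
    ≡⟨ cong (λ l → ∑ lo l (λ i → multFrom lo i (x ∷ xs))) (+-∸-assoc 1 lo≤k) ⟩
  multFrom lo lo (x ∷ xs) + ∑ (suc lo) (k ∸ lo) (λ i → multFrom lo i (x ∷ xs))
    ≡⟨ cong₂ _+_ (multFrom-here lo x xs)
                 (∑-cong (suc lo) (k ∸ lo) λ i lo<i _ → multFrom-there x xs (≢-sym (<⇒≢ lo<i))) ⟩
  x + ∑ (suc lo) (k ∸ lo) (λ i → multFrom (suc lo) i xs) ∎
  where open ≡-Reasoning

-- f k / (1 + d) is the fraction a_k / den p a_k, where p is pre plus the multiplicities of the labels before k.
record Fractions (den : ℕ → ℕ → ℕ) (lo pre : ℕ) (a : List ℕ) (f : ℕ → ℕ) (d : ℕ) : Set where
  field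
    cross   : ∀ k → lo ≤ k → k < lo + length a →
              den (pre + ∑ lo (k ∸ lo) (λ i → multFrom lo i a)) (multFrom lo k a) * f k ≡ multFrom lo k a * suc d
    support : ∀ k → lo ≤ k → k < lo + length a → multFrom lo k a ≡ 0 → f k ≡ 0

module _ {den lo pre x xs f d} (fr : Fractions den lo pre (x ∷ xs) f d) where
  open Fractions fr

  Fractions-head : den pre x * f lo ≡ x * suc d × (x ≡ 0 → f lo ≡ 0)
  Fractions-head = cross-head , λ x≡0 → support lo ≤-refl lo<u (trans (multFrom-here lo x xs) x≡0)
    where
    open ≡-Reasoning
    lo<u = lo<lo+suc lo (length xs)
    aₗₒ = λ i → multFrom lo i (x ∷ xs)
    prefix≡pre : pre + ∑ lo (lo ∸ lo) aₗₒ ≡ pre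
    prefix≡pre = trans (cong (λ l → pre + ∑ lo l aₗₒ) (n∸n≡0 lo)) (+-identityʳ pre)
    cross-head : den pre x * f lo ≡ x * suc d
    cross-head = begin
      den pre x * f lo
        ≡⟨ cong₂ (λ p y → den p y * f lo) (sym prefix≡pre) (sym (multFrom-here lo x xs)) ⟩
      den (pre + ∑ lo (lo ∸ lo) aₗₒ) (multFrom lo lo (x ∷ xs)) * f lo
        ≡⟨ cross lo ≤-refl lo<u ⟩
      multFrom lo lo (x ∷ xs) * suc d
        ≡⟨ cong (_* suc d) (multFrom-here lo x xs) ⟩
      x * suc d ∎

  Fractions-tail : Fractions den (suc lo) (pre + x) xs f d
  Fractions-tail = record { cross = cross′ ; support = support′ }
    where
    open ≡-Reasoning
    cross′ : ∀ k → suc lo ≤ k → k < suc lo + length xs →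
             den (pre + x + ∑ (suc lo) (k ∸ suc lo) (λ i → multFrom (suc lo) i xs)) (multFrom (suc lo) k xs) * f k ≡
             multFrom (suc lo) k xs * suc d
    cross′ k lo<k k<u = begin
      den (pre + x + ∑ (suc lo) (k ∸ suc lo) (λ i → multFrom (suc lo) i xs)) (multFrom (suc lo) k xs) * f k
        ≡⟨ cong₂ (λ p y → den p y * f k) (trans (+-assoc pre x _) (cong (pre +_) (sym (∑-multFrom-∷ x xs lo<k))))
                                         (sym (multFrom-there x xs (≢-sym (<⇒≢ lo<k)))) ⟩
      den (pre + ∑ lo (k ∸ lo) (λ i → multFrom lo i (x ∷ xs))) (multFrom lo k (x ∷ xs)) * f k
        ≡⟨ cross k (<⇒≤ lo<k) (shiftʳ lo (length xs) k<u) ⟩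
      multFrom lo k (x ∷ xs) * suc d
        ≡⟨ cong (_* suc d) (multFrom-there x xs (≢-sym (<⇒≢ lo<k))) ⟩
      multFrom (suc lo) k xs * suc d ∎
    support′ : ∀ k → suc lo ≤ k → k < suc lo + length xs → multFrom (suc lo) k xs ≡ 0 → f k ≡ 0
    support′ k lo<k k<u mult≡0 =
      support k (<⇒≤ lo<k) (shiftʳ lo (length xs) k<u) (trans (multFrom-there x xs (≢-sym (<⇒≢ lo<k))) mult≡0)

∑-/-frac-sum : ∀ den lo pre a (f : ℕ → ℕ) d → Fractions den lo pre a f d →
               ℤ.+ ∑ lo (length a) f / suc d ≡ frac-sum den pre a
∑-/-frac-sum den lo pre []       f d _  = ℚₚ.0/n≡0 (suc d)
∑-/-frac-sum den lo pre (x ∷ xs) f d fr = begin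
  ℤ.+ (f lo + ∑ (suc lo) (length xs) f) / suc d            ≡⟨ /-distrib-+ (f lo) _ d ⟩
  ℤ.+ f lo / suc d +ℚ ℤ.+ ∑ (suc lo) (length xs) f / suc d ≡⟨ cong (ℤ.+ f lo / suc d +ℚ_) rest ⟩
  ℤ.+ f lo / suc d +ℚ frac-sum den (pre + x) xs            ≡⟨ head x (Fractions-head fr) ⟩
  frac-sum den pre (x ∷ xs)                                ∎
  where
  open ≡-Reasoning
  rest : ℤ.+ ∑ (suc lo) (length xs) f / suc d ≡ frac-sum den (pre + x) xs
  rest = ∑-/-frac-sum den (suc lo) (pre + x) xs f d (Fractions-tail fr)
  head : ∀ x → den pre x * f lo ≡ x * suc d × (x ≡ 0 → f lo ≡ 0) →
         ℤ.+ f lo / suc d +ℚ frac-sum den (pre + x) xs ≡ frac-sum den pre (x ∷ xs)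
  head zero    (_ , f≡0) = begin
    ℤ.+ f lo / suc d +ℚ frac-sum den (pre + 0) xs
      ≡⟨ cong₂ (λ y p → ℤ.+ y / suc d +ℚ frac-sum den p xs) (f≡0 refl) (+-identityʳ pre) ⟩
    ℤ.+ 0 / suc d +ℚ frac-sum den pre xs
      ≡⟨ cong (_+ℚ frac-sum den pre xs) (ℚₚ.0/n≡0 (suc d)) ⟩
    0ℚ +ℚ frac-sum den pre xs
      ≡⟨ ℚₚ.+-identityˡ _ ⟩
    frac-sum den pre xs ∎
  head (suc j) (cross , _) =
    cong (_+ℚ frac-sum den (pre + suc j) xs) (/-≡-frac (f lo) (suc j) (den pre (suc j)) d (s≤s z≤n) cross)

expect-deckSum : ∀ X a d → deckSize a ≡ suc d → expect X a ≡ ℤ.+ deckSum X a / suc d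
expect-deckSum X a d N≡ =
  average≡ (map X (deckWords a)) (trans (length-map X (deckWords a)) (trans (length≡deckSize (deckWords a)) N≡))
  where
  average≡ : ∀ ys → length ys ≡ suc d → average ys ≡ ℤ.+ sum ys / suc d
  average≡ (y ∷ ys) refl = refl
  length≡deckSize : ∀ (ws : List (List ℕ)) → length ws ≡ sum (map (λ _ → 1) ws)
  length≡deckSize []       = refl
  length≡deckSize (_ ∷ ws) = cong suc (length≡deckSize ws)

expect-firstPileSize : ∀ fits T den a → (∀ c → c < 1 + length a → fits T c ≡ true) →
  (∀ k → 1 ≤ k → k < 1 + length a →
     den (below k a) (mult k a) * deckSum (firstPileCount fits k T) a ≡ mult k a * deckSize a) →
  expect (λ w → firstPileSize (patience fits w)) a ≡ frac-sum den 0 a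
expect-firstPileSize fits T den a fitsᵀ counts = begin
  expect (λ w → firstPileSize (patience fits w)) a
    ≡⟨ expect-deckSum _ a d N≡ ⟩
  ℤ.+ deckSum (λ w → firstPileSize (patience fits w)) a / suc d
    ≡⟨ cong (λ x → ℤ.+ x / suc d) (deckSum-firstPileSize fits T a fitsᵀ) ⟩
  ℤ.+ ∑ 1 (length a) (λ k → deckSum (firstPileCount fits k T) a) / suc d
    ≡⟨ ∑-/-frac-sum den 1 0 a _ d (record { cross = cross ; support = support }) ⟩
  frac-sum den 0 a ∎
  where
  open ≡-Reasoning
  d = pred (deckSize a)
  N≡ : deckSize a ≡ suc d
  N≡ = sym (suc-pred (deckSize a) {{>-nonZero (deckSize-pos a)}})
  cross : ∀ k → 1 ≤ k → k < 1 + length a →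
          den (below k a) (mult k a) * deckSum (firstPileCount fits k T) a ≡ mult k a * suc d
  cross k 1≤k k<1+m = trans (counts k 1≤k k<1+m) (cong (mult k a *_) N≡)
  support : ∀ k → 1 ≤ k → k < 1 + length a → mult k a ≡ 0 → deckSum (firstPileCount fits k T) a ≡ 0
  support k _ _ = deckSum-firstPileCount-absent fits a k T

mainTheorem11 : (a : List ℕ) → sum a ≥ 1 →
    (expect P₁ a ≡ formula₁ 0 a) × (expect P₁' a ≡ formula₂ 0 a)
mainTheorem11 a _ =
  trans (expect-firstPileSize tiesAllowed m (λ p _ → p + 1) a weak-fits weak) (sym (formula₁≡frac-sum 0 a)) ,
  trans (expect-firstPileSize tiesForbidden (suc m) _+_ a (λ _ → fits-strict) strict) (sym (formula₂≡frac-sum 0 a))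
  where
  m = length a
  weak-fits : ∀ c → c < 1 + m → tiesAllowed m c ≡ true
  weak-fits _ c<1+m = fits-weak (≤-pred c<1+m)
  weak : ∀ k → 1 ≤ k → k < 1 + m →
         (below k a + 1) * deckSum (firstPileCount tiesAllowed k m) a ≡ mult k a * deckSize a
  weak k 1≤k k<1+m = deckSum-firstPileCount-weak (sum a) a k m refl 1≤k (≤-pred k<1+m) (≤-pred k<1+m)
  strict : ∀ k → 1 ≤ k → k < 1 + m →
           (below k a + mult k a) * deckSum (firstPileCount tiesForbidden k (suc m)) a ≡ mult k a * deckSize a
  strict k 1≤k k<1+m = deckSum-firstPileCount-strict (sum a) a k (suc m) refl 1≤k (≤-pred k<1+m) k<1+m
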